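{- Let $T$ be a tree. Then $\mathcal{TE}_-(T)$ is connected.
   Context: Skew forcing on a graph $G$: vertices are blue or white; starting from an initial blue set $B$ (possibly empty), repeatedly apply: if any vertex $u$ (blue or white) has exactly one white neighbor $w$, then $w$ becomes blue. $B$ is a skew forcing set if eventually all vertices are blue; $\mathrm{Z}_-(G)$ is the minimum size of a skew forcing set. $\mathcal{TE}_-(G)$ has as vertices the skew forcing sets of size $\mathrm{Z}_-(G)$, with $S_1S_2$ an edge iff there are $v_1\in S_1\setminus S_2$, $v_2\in S_2\setminus S_1$ with $S_1\setminus\{v_1\}=S_2\setminus\{v_2\}$. -}

module Defs where

open import Data.Nat using (ℕ; suc; _≤_)
open import Data.Fin using (Fin; zero; suc; inject₁; fromℕ)
open import Data.Fin.Subset using (Subset; _∈_; _∉_; ∣_∣; _∩_; ∁; ⁅_⁆)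
open import Data.Bool using (Bool; true; false)
open import Data.Product using (Σ; ∃; _×_; _,_)
open import Relation.Binary.PropositionalEquality using (_≡_; _≢_)
open import Relation.Binary.Construct.Closure.ReflexiveTransitive using (Star)
open import Relation.Nullary using (¬_)
open import Function.Definitions using (Injective)

record Graph (n : ℕ) : Set where
  field
    adj     : Fin n → Fin n → Bool
    adj-sym : ∀ u v → adj u v ≡ adj v u
    irrefl  : ∀ u → adj u u ≡ false

module _ {n : ℕ} (G : Graph n) where
  open Graph G

  Adj : Fin n → Fin n → Set
  Adj u v = adj u v ≡ true

  Connected : Set
  Connected = ∀ u v → Star Adj u v

  -- A cycle of length k+3 (≥ 3): an injective closed walk c 0, …, c (k+2)
  record Cycle (k : ℕ) : Set where
    field
      c       : Fin (suc (suc (suc k))) → Fin n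
      inj     : Injective _≡_ _≡_ c
      steps   : ∀ (i : Fin (suc (suc k))) → Adj (c (inject₁ i)) (c (suc i))
      closing : Adj (c (fromℕ (suc (suc k)))) (c zero)

  Acyclic : Set
  Acyclic = ∀ k → ¬ Cycle k

  IsTree : Set
  IsTree = Connected × Acyclic

  -- Vertices eventually coloured blue by skew forcing from initial blue set B.
  data Blue (B : Subset n) : Fin n → Set where
    initial : ∀ {v} → v ∈ B → Blue B v
    force   : ∀ {w} u → Adj u w → (∀ x → Adj u x → x ≢ w → Blue B x) → Blue B w

  SkewForcingSet : Subset n → Set
  SkewForcingSet B = ∀ v → Blue B v

  -- B is a skew forcing set of size Z₋(G)
  MinSkewForcingSet : Subset n → Set
  MinSkewForcingSet B =
    SkewForcingSet B × (∀ B′ → SkewForcingSet B′ → ∣ B ∣ ≤ ∣ B′ ∣)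

  -- Adjacency in the token-exchange graph TE₋(G)
  TEAdj : Subset n → Subset n → Set
  TEAdj S₁ S₂ =
    MinSkewForcingSet S₁ × MinSkewForcingSet S₂ ×
    Σ (Fin n) λ v₁ → Σ (Fin n) λ v₂ →
      v₁ ∈ S₁ × v₁ ∉ S₂ × v₂ ∈ S₂ × v₂ ∉ S₁ ×
      (S₁ ∩ ∁ ⁅ v₁ ⁆ ≡ S₂ ∩ ∁ ⁅ v₂ ⁆)

  TEConnected : Set
  TEConnected = ∀ S₁ S₂ → MinSkewForcingSet S₁ → MinSkewForcingSet S₂ → Star TEAdj S₁ S₂

-- In a forest a set S is skew forcing exactly when some matching covers every
-- vertex outside S. One direction holds in every graph: the first force whose
-- target w lies outside S is used to match w, by induction on the number of
-- vertices outside S. Conversely a vertex outside S is forced by its partner,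
-- and justifying the other neighbours of that partner recursively follows a
-- non-backtracking walk, which has no repeated vertex in an acyclic graph and
-- so ends. Hence a minimum skew forcing set is the set of vertices exposed by
-- its matching. For minimum sets S₁, S₂ and x ∈ S₂ ∖ S₁, follow the walk that
-- starts at x and alternates between the two matchings until it gets stuck at
-- some y. Switching the matchings along the walk either shows that S₁ - y + x,
-- a neighbour of S₁ in TE₋, is again a minimum skew forcing set, with y ∉ S₂;
-- or that S₂ - x is skew forcing, which contradicts the minimality of S₂.
-- Each exchange shrinks S₂ ∖ S₁, and an empty difference forces S₁ = S₂.
module Submission where

open import Data.Bool using (Bool; true; false; not)
open import Data.Bool.Properties using (not-involutive; ¬-not) renaming (_≟_ to _≟ᵇ_)
open import Data.Empty using (⊥)
open import Data.Fin using (Fin; zero; suc; toℕ; inject₁; fromℕ)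
open import Data.Fin.Properties using (_≟_; any?; pigeonhole)
open import Data.Fin.Subset
  using (Subset; inside; outside; _∈_; _∉_; _⊆_; _∪_; _∩_; ∁; ⁅_⁆; _-_; ∣_∣)
open import Data.Fin.Subset.Properties
  using ( _∈?_; x∈⁅x⁆; x∈⁅y⁆⇒x≡y; x≢y⇒x∉⁅y⁆; x∈∁p⇒x∉p; x∉p⇒x∈∁p; x∈p⇒x∉∁p
        ; x∈p∩q⁺; x∈p∩q⁻; x∈p∪q⁺; x∈p∪q⁻; p⊆p∪q; p∩q⊆p; ⊆-antisym; ∪-identityʳ
        ; p⊂q⇒∣p∣<∣q∣; x∈p∧x≢y⇒x∈p-y; x∈p⇒∣p-x∣<∣p∣ )
open import Data.List using (List; []; _∷_; _++_; [_]; length; lookup; head)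
open import Data.List.Membership.Propositional using () renaming (_∈_ to _∈ₗ_; _∉_ to _∉ₗ_)
open import Data.List.Membership.Propositional.Properties using (∈-lookup; ∈-∃++)
open import Data.List.Properties using (++-assoc)
import Data.List.Relation.Unary.All as All
import Data.List.Relation.Unary.All.Properties as Allₚ
open import Data.List.Relation.Unary.AllPairs as AllPairs using (AllPairs)
open import Data.List.Relation.Unary.Any using (here; there)
open import Data.List.Relation.Unary.Linked as Linked using (Linked; [-])
open import Data.List.Relation.Unary.Unique.Propositional using (Unique)
open import Data.Maybe using (Maybe; just; nothing)
open import Data.Maybe.Properties using (just-injective)
open import Data.Nat using (ℕ; zero; suc; _+_; _≤_; _<_; s≤s)
open import Data.Nat.Properties
  using ( ≤-refl; ≤-trans; <-trans; <-≤-trans; <-irrefl; ≤-pred; n≤1+n; m≤m+n; m≤n+m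
        ; +-suc; +-monoʳ-≤; _≤?_; ≰⇒>; <⇒≱; ≤⇒≯ )
open import Data.Product using (Σ; ∃; _×_; _,_; proj₁; proj₂)
open import Data.Sum using (_⊎_; inj₁; inj₂)
open import Data.Unit using (⊤; tt)
open import Data.Vec using ([]; _∷_)
open import Level using (0ℓ)
open import Relation.Binary.Core using (Rel)
open import Relation.Binary.Construct.Closure.ReflexiveTransitive using (Star; ε; _◅_)
open import Relation.Binary.PropositionalEquality using (_≡_; _≢_; refl; sym; trans; cong; subst)
open import Relation.Nullary using (¬_; Dec; yes; no; contradiction; ¬?)
open import Relation.Nullary.Decidable using (_×-dec_)
open import Defs

∣p∪⁅x⁆∣≤1+∣p∣ : ∀ {n} (p : Subset n) x → ∣ p ∪ ⁅ x ⁆ ∣ ≤ suc ∣ p ∣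
∣p∪⁅x⁆∣≤1+∣p∣ (outside ∷ p) zero rewrite ∪-identityʳ p = ≤-refl
∣p∪⁅x⁆∣≤1+∣p∣ (inside ∷ p) zero rewrite ∪-identityʳ p = n≤1+n _
∣p∪⁅x⁆∣≤1+∣p∣ (outside ∷ p) (suc x) = ∣p∪⁅x⁆∣≤1+∣p∣ p x
∣p∪⁅x⁆∣≤1+∣p∣ (inside ∷ p) (suc x) = s≤s (∣p∪⁅x⁆∣≤1+∣p∣ p x)

module _ {n : ℕ} where

  x≢y⇒x∈∁⁅y⁆ : ∀ {x y : Fin n} → x ≢ y → x ∈ ∁ ⁅ y ⁆
  x≢y⇒x∈∁⁅y⁆ x≢y = x∉p⇒x∈∁p (x≢y⇒x∉⁅y⁆ x≢y)

  x∈∁⁅y⁆⇒x≢y : ∀ {x y : Fin n} → x ∈ ∁ ⁅ y ⁆ → x ≢ y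
  x∈∁⁅y⁆⇒x≢y {x} x∈ refl = x∈∁p⇒x∉p x∈ (x∈⁅x⁆ x)

  x∉p∧x≢y⇒x∉p∪⁅y⁆ : ∀ {p : Subset n} {x y} → x ∉ p → x ≢ y → x ∉ p ∪ ⁅ y ⁆
  x∉p∧x≢y⇒x∉p∪⁅y⁆ {p} {y = y} x∉p x≢y x∈ with x∈p∪q⁻ p ⁅ y ⁆ x∈
  ... | inj₁ x∈p = x∉p x∈p
  ... | inj₂ x∈⁅y⁆ = x≢y (x∈⁅y⁆⇒x≡y y x∈⁅y⁆)

  x∉p⇒∣∁[p∪⁅x⁆]∣<∣∁p∣ : ∀ {p : Subset n} {x} → x ∉ p → ∣ ∁ (p ∪ ⁅ x ⁆) ∣ < ∣ ∁ p ∣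
  x∉p⇒∣∁[p∪⁅x⁆]∣<∣∁p∣ {p} {x} x∉p =
    p⊂q⇒∣p∣<∣q∣ (shrinks , x , x∉p⇒x∈∁p x∉p , x∈p⇒x∉∁p (x∈p∪q⁺ (inj₂ (x∈⁅x⁆ x))))
    where
    shrinks : ∁ (p ∪ ⁅ x ⁆) ⊆ ∁ p
    shrinks v∈ = x∉p⇒x∈∁p (λ v∈p → x∈∁p⇒x∉p v∈ (p⊆p∪q ⁅ x ⁆ v∈p))

  p⊆q∧∣q∣≤∣p∣⇒p≡q : ∀ {p q : Subset n} → p ⊆ q → ∣ q ∣ ≤ ∣ p ∣ → p ≡ q
  p⊆q∧∣q∣≤∣p∣⇒p≡q {p} {q} p⊆q ∣q∣≤∣p∣ = ⊆-antisym p⊆q q⊆p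
    where
    q⊆p : q ⊆ p
    q⊆p {v} v∈q with v ∈? p
    ... | yes v∈p = v∈p
    ... | no v∉p = contradiction (p⊂q⇒∣p∣<∣q∣ (p⊆q , v , v∈q , v∉p)) (≤⇒≯ ∣q∣≤∣p∣)

  replace : Subset n → Fin n → Fin n → Subset n
  replace S y x = (S ∩ ∁ ⁅ y ⁆) ∪ ⁅ x ⁆

  x∈replace : ∀ {S y} x → x ∈ replace S y x
  x∈replace x = x∈p∪q⁺ (inj₂ (x∈⁅x⁆ x))

  ∈replace⁺ : ∀ {S y x v} → v ∈ S → v ≢ y → v ∈ replace S y x
  ∈replace⁺ v∈S v≢y = x∈p∪q⁺ (inj₁ (x∈p∩q⁺ (v∈S , x≢y⇒x∈∁⁅y⁆ v≢y)))

  ∈replace⁻ : ∀ {S y x v} → v ∈ replace S y x → v ≡ x ⊎ (v ∈ S × v ≢ y)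
  ∈replace⁻ {S} {y} {x} v∈ with x∈p∪q⁻ (S ∩ ∁ ⁅ y ⁆) ⁅ x ⁆ v∈
  ... | inj₂ v∈⁅x⁆ = inj₁ (x∈⁅y⁆⇒x≡y x v∈⁅x⁆)
  ... | inj₁ v∈S∖y with x∈p∩q⁻ S (∁ ⁅ y ⁆) v∈S∖y
  ...   | v∈S , v∈∁y = inj₂ (v∈S , x∈∁⁅y⁆⇒x≢y v∈∁y)

  ∉replace⇒≢ : ∀ {S y x v} → v ∉ replace S y x → v ≢ x
  ∉replace⇒≢ v∉ refl = v∉ (x∈replace _)

  y∉replace : ∀ {S y x} → y ≢ x → y ∉ replace S y x
  y∉replace y≢x y∈ with ∈replace⁻ y∈
  ... | inj₁ y≡x = y≢x y≡x
  ... | inj₂ (_ , y≢y) = y≢y refl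

  replace-∩∁ : ∀ {S y x} → x ∉ S → S ∩ ∁ ⁅ y ⁆ ≡ replace S y x ∩ ∁ ⁅ x ⁆
  replace-∩∁ {S} {y} {x} x∉S = ⊆-antisym ⊆replace ⊇replace
    where
    ⊆replace : S ∩ ∁ ⁅ y ⁆ ⊆ replace S y x ∩ ∁ ⁅ x ⁆
    ⊆replace v∈ with x∈p∩q⁻ S (∁ ⁅ y ⁆) v∈
    ... | v∈S , _ = x∈p∩q⁺ (x∈p∪q⁺ (inj₁ v∈) , x≢y⇒x∈∁⁅y⁆ λ { refl → x∉S v∈S })
    ⊇replace : replace S y x ∩ ∁ ⁅ x ⁆ ⊆ S ∩ ∁ ⁅ y ⁆
    ⊇replace v∈ with x∈p∩q⁻ (replace S y x) (∁ ⁅ x ⁆) v∈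
    ... | v∈S′ , v∈∁x with ∈replace⁻ v∈S′
    ...   | inj₁ v≡x = contradiction v≡x (x∈∁⁅y⁆⇒x≢y v∈∁x)
    ...   | inj₂ (v∈S , v≢y) = x∈p∩q⁺ (v∈S , x≢y⇒x∈∁⁅y⁆ v≢y)

  ∣replace∣≤∣S∣ : ∀ {S y} x → y ∈ S → ∣ replace S y x ∣ ≤ ∣ S ∣
  ∣replace∣≤∣S∣ {S} {y} x y∈S = ≤-trans (∣p∪⁅x⁆∣≤1+∣p∣ (S ∩ ∁ ⁅ y ⁆) x)
    (p⊂q⇒∣p∣<∣q∣ (p∩q⊆p S (∁ ⁅ y ⁆) , y , y∈S , λ y∈ → x∈∁⁅y⁆⇒x≢y (proj₂ (x∈p∩q⁻ S _ y∈)) refl))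

  ∣T∖replace∣<∣T∖S∣ : ∀ {S T y x} → y ∉ T → x ∈ T → x ∉ S →
                      ∣ T ∩ ∁ (replace S y x) ∣ < ∣ T ∩ ∁ S ∣
  ∣T∖replace∣<∣T∖S∣ {S} {T} {y} {x} y∉T x∈T x∉S =
    p⊂q⇒∣p∣<∣q∣ (shrinks , x , x∈p∩q⁺ (x∈T , x∉p⇒x∈∁p x∉S) , x∉T∖S′)
    where
    shrinks : T ∩ ∁ (replace S y x) ⊆ T ∩ ∁ S
    shrinks v∈ with x∈p∩q⁻ T (∁ (replace S y x)) v∈
    ... | v∈T , v∉S′ = x∈p∩q⁺ (v∈T , x∉p⇒x∈∁p λ v∈S →
      x∈∁p⇒x∉p v∉S′ (∈replace⁺ v∈S λ { refl → y∉T v∈T }))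
    x∉T∖S′ : x ∉ T ∩ ∁ (replace S y x)
    x∉T∖S′ x∈ = x∈∁p⇒x∉p (proj₂ (x∈p∩q⁻ T _ x∈)) (x∈replace x)

module _ {A : Set} where

  NonBacktracking : List A → Set
  NonBacktracking (x ∷ y ∷ z ∷ ws) = x ≢ z × NonBacktracking (y ∷ z ∷ ws)
  NonBacktracking _ = ⊤

  NonBacktracking-tail : ∀ {x ws} → NonBacktracking (x ∷ ws) → NonBacktracking ws
  NonBacktracking-tail {ws = []} _ = tt
  NonBacktracking-tail {ws = _ ∷ []} _ = tt
  NonBacktracking-tail {ws = _ ∷ _ ∷ _} (_ , nb) = nb

  Linked-++⁻ˡ : ∀ {R : Rel A 0ℓ} xs {ys} → Linked R (xs ++ ys) → Linked R xs
  Linked-++⁻ˡ [] _ = Linked.[]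
  Linked-++⁻ˡ (x ∷ []) _ = [-]
  Linked-++⁻ˡ (x ∷ y ∷ xs) (r Linked.∷ rs) = r Linked.∷ Linked-++⁻ˡ (y ∷ xs) rs

  Linked-lookup : ∀ {R : Rel A 0ℓ} {x ys} → Linked R (x ∷ ys) →
                  ∀ i → R (lookup (x ∷ ys) (inject₁ i)) (lookup (x ∷ ys) (suc i))
  Linked-lookup (r Linked.∷ _) zero = r
  Linked-lookup (_ Linked.∷ rs) (suc i) = Linked-lookup rs i

  AllPairs-++⁻ˡ : ∀ {R : Rel A 0ℓ} xs {ys} → AllPairs R (xs ++ ys) → AllPairs R xs
  AllPairs-++⁻ˡ [] _ = AllPairs.[]
  AllPairs-++⁻ˡ (x ∷ xs) (px AllPairs.∷ pxs) = Allₚ.++⁻ˡ xs px AllPairs.∷ AllPairs-++⁻ˡ xs pxs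

  Unique-lookup-injective : ∀ {xs : List A} → Unique xs →
                            ∀ {i j} → lookup xs i ≡ lookup xs j → i ≡ j
  Unique-lookup-injective {_ ∷ _} _ {zero} {zero} _ = refl
  Unique-lookup-injective {_ ∷ _} (x∉ AllPairs.∷ _) {zero} {suc j} eq =
    contradiction eq (All.lookup x∉ (∈-lookup j))
  Unique-lookup-injective {_ ∷ _} (x∉ AllPairs.∷ _) {suc i} {zero} eq =
    contradiction (sym eq) (All.lookup x∉ (∈-lookup i))
  Unique-lookup-injective {_ ∷ _} (_ AllPairs.∷ u) {suc i} {suc j} eq =
    cong suc (Unique-lookup-injective u eq)

  lookup-fromℕ-∷ʳ : ∀ (x : A) ys z → lookup (x ∷ ys ++ [ z ]) (fromℕ (length (ys ++ [ z ]))) ≡ z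
  lookup-fromℕ-∷ʳ x [] z = refl
  lookup-fromℕ-∷ʳ x (y ∷ ys) z = lookup-fromℕ-∷ʳ y ys z

  head≡just⇒∈ : ∀ {ws : List A} {u} → head ws ≡ just u → u ∈ₗ ws
  head≡just⇒∈ {_ ∷ _} eq = here (sym (just-injective eq))

Unique⇒length≤ : ∀ {n} {xs : List (Fin n)} → Unique xs → length xs ≤ n
Unique⇒length≤ {n} {xs} u with length xs ≤? n
... | yes ≤n = ≤n
... | no ≰n with pigeonhole (≰⇒> ≰n) (lookup xs)
...   | i , j , i<j , eq =
  contradiction (cong toℕ (Unique-lookup-injective u eq)) (λ i≡j → <-irrefl i≡j i<j)

module _ {n : ℕ} (G : Graph n) where
  open Graph G
  open import Data.List.Membership.DecPropositional {A = Fin n} _≟_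
    using () renaming (_∈?_ to _∈ₗ?_)

  Adj-sym : ∀ {u v} → Adj G u v → Adj G v u
  Adj-sym {u} {v} uv = trans (adj-sym v u) uv

  Adj-irrefl : ∀ {u} → ¬ Adj G u u
  Adj-irrefl {u} uu with trans (sym (irrefl u)) uu
  ... | ()

  Adj? : ∀ u v → Dec (Adj G u v)
  Adj? u v = adj u v ≟ᵇ true

  Mate : Set
  Mate = Fin n → Maybe (Fin n)

  IsMatching : Mate → Set
  IsMatching m = ∀ {u v} → m u ≡ just v → Adj G u v × m v ≡ just u

  Matched : Mate → Fin n → Set
  Matched m v = ∃ λ u → m v ≡ just u

  Covers : Mate → Subset n → Set
  Covers m S = ∀ {v} → v ∉ S → Matched m v

  CoveringMatching : Subset n → Set
  CoveringMatching S = Σ Mate λ m → IsMatching m × Covers m S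

  unmatched⇒∈ : ∀ {m S v} → Covers m S → m v ≡ nothing → v ∈ S
  unmatched⇒∈ {S = S} {v} covers mv with v ∈? S
  ... | yes v∈S = v∈S
  ... | no v∉S with covers v∉S
  ...   | _ , mv′ with trans (sym mv) mv′
  ...     | ()

  record ExactMatching (S : Subset n) : Set where
    field
      mate : Mate
      isMatching : IsMatching mate
      covers : Covers mate S
      exposes : ∀ {v} → v ∈ S → mate v ≡ nothing

    matched⇒∉ : ∀ {v} → Matched mate v → v ∉ S
    matched⇒∉ (_ , e) v∈S with trans (sym (exposes v∈S)) e
    ... | ()

  -- Matchings from skew forcing sets

  record Force (S : Subset n) : Set where
    constructor mkForce
    field
      {forcer target} : Fin n
      edge : Adj G forcer target
      target∉ : target ∉ S
      others∈ : ∀ x → Adj G forcer x → x ≢ target → x ∈ S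

  Blue-mono : ∀ {S S′ v} → S ⊆ S′ → Blue G S v → Blue G S′ v
  Blue-mono S⊆S′ (initial v∈S) = initial (S⊆S′ v∈S)
  Blue-mono S⊆S′ (force u uw blue) = force u uw (λ x ux x≢w → Blue-mono S⊆S′ (blue x ux x≢w))

  -- Descend into the derivation until every other premise of the force lies in S.
  Blue∧∉⇒Force : ∀ {S v} → Blue G S v → v ∉ S → Force S
  Blue∧∉⇒Force (initial v∈S) v∉S = contradiction v∈S v∉S
  Blue∧∉⇒Force {S} (force {w} u uw blue) w∉S
    with any? (λ x → Adj? u x ×-dec ¬? (x ≟ w) ×-dec ¬? (x ∈? S))
  ... | yes (x , ux , x≢w , x∉S) = Blue∧∉⇒Force (blue x ux x≢w) x∉S
  ... | no none = mkForce uw w∉S others∈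
    where
    others∈ : ∀ x → Adj G u x → x ≢ w → x ∈ S
    others∈ x ux x≢w with x ∈? S
    ... | yes x∈S = x∈S
    ... | no x∉S = contradiction (x , ux , x≢w , x∉S) none

  _without_ : Maybe (Fin n) → Fin n → Maybe (Fin n)
  nothing without u = nothing
  just a without u with a ≟ u
  ... | yes _ = nothing
  ... | no _ = just a

  without≡just : ∀ {mv u a} → mv without u ≡ just a → mv ≡ just a × a ≢ u
  without≡just {just b} {u} eq with b ≟ u
  without≡just {just b} {u} refl | no b≢u = refl , b≢u

  just-without : ∀ {a u} → a ≢ u → just a without u ≡ just a
  just-without {a} {u} a≢u with a ≟ u
  ... | yes a≡u = contradiction a≡u a≢u
  ... | no _ = refl

  -- Match u with w; the former partner of u becomes unmatched.
  augment : Mate → Fin n → Fin n → Mate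
  augment m u w v with v ≟ u | v ≟ w
  ... | yes _ | _ = just w
  ... | no _ | yes _ = just u
  ... | no _ | no _ = m v without u

  augment-forcer : ∀ m u w → augment m u w u ≡ just w
  augment-forcer m u w with u ≟ u
  ... | yes _ = refl
  ... | no u≢u = contradiction refl u≢u

  augment-target : ∀ m u w → u ≢ w → augment m u w w ≡ just u
  augment-target m u w u≢w with w ≟ u | w ≟ w
  ... | yes w≡u | _ = contradiction (sym w≡u) u≢w
  ... | no _ | yes _ = refl
  ... | no _ | no w≢w = contradiction refl w≢w

  augment-other : ∀ m {u w v} → v ≢ u → v ≢ w → augment m u w v ≡ m v without u
  augment-other m {u} {w} {v} v≢u v≢w with v ≟ u | v ≟ w
  ... | yes v≡u | _ = contradiction v≡u v≢u
  ... | no _ | yes v≡w = contradiction v≡w v≢w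
  ... | no _ | no _ = refl

  augment-isMatching : ∀ {m u w} → IsMatching m → Adj G u w → m w ≡ nothing →
                       IsMatching (augment m u w)
  augment-isMatching {m} {u} {w} isM uw mw {v} {a} eq with v ≟ u | v ≟ w
  ... | yes refl | _ rewrite sym (just-injective eq) =
    uw , augment-target m v w (λ { refl → Adj-irrefl uw })
  ... | no _ | yes refl rewrite sym (just-injective eq) = Adj-sym uw , augment-forcer m u v
  ... | no v≢u | no v≢w with without≡just eq
  ...   | mv , a≢u with isM mv
  ...     | va , ma =
    va , trans (augment-other m a≢u a≢w) (trans (cong (_without u) ma) (just-without v≢u))
    where
    a≢w : a ≢ w
    a≢w refl with trans (sym ma) mw
    ... | ()

  augment-covers : ∀ {m S} (F : Force S) → IsMatching m → Covers m (S ∪ ⁅ Force.target F ⁆) →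
                   Covers (augment m (Force.forcer F) (Force.target F)) S
  augment-covers {m} {S} (mkForce {u} {w} uw w∉S others∈) isM covers {v} v∉S with v ≟ u | v ≟ w
  ... | yes _ | _ = w , refl
  ... | no _ | yes _ = u , refl
  ... | no v≢u | no v≢w with covers (x∉p∧x≢y⇒x∉p∪⁅y⁆ v∉S v≢w)
  ...   | a , mv with a ≟ u
  ...     | yes refl = contradiction (others∈ v (Adj-sym (proj₁ (isM mv))) v≢w) v∉S
  ...     | no a≢u = a , trans (cong (_without u) mv) (just-without a≢u)

  skewForcing⇒covering′ : ∀ k S → ∣ ∁ S ∣ < k → SkewForcingSet G S → CoveringMatching S
  skewForcing⇒covering′ k S _ forcing with any? (λ v → ¬? (v ∈? S))
  ... | no none = (λ _ → nothing) , (λ ()) , λ {v} v∉S → contradiction (v , v∉S) none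
  skewForcing⇒covering′ (suc k) S ∣∁S∣≤k forcing | yes (v , v∉S) with Blue∧∉⇒Force (forcing v) v∉S
  ... | F@(mkForce {u} {w} uw w∉S _)
    with skewForcing⇒covering′ k (S ∪ ⁅ w ⁆)
           (<-≤-trans (x∉p⇒∣∁[p∪⁅x⁆]∣<∣∁p∣ w∉S) (≤-pred ∣∁S∣≤k))
           (λ x → Blue-mono (p⊆p∪q ⁅ w ⁆) (forcing x))
  ... | m , isM , covers with m w in mw
  ...   | nothing = augment m u w , augment-isMatching isM uw mw , augment-covers F isM covers
  ...   | just b = m , isM , covers′
    where
    covers′ : Covers m S
    covers′ {x} x∉S with x ≟ w
    ... | yes refl = b , mw
    ... | no x≢w = covers (x∉p∧x≢y⇒x∉p∪⁅y⁆ x∉S x≢w)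

  skewForcing⇒covering : ∀ {S} → SkewForcingSet G S → CoveringMatching S
  skewForcing⇒covering {S} = skewForcing⇒covering′ (suc ∣ ∁ S ∣) S ≤-refl

  -- Switching matchings

  Closed : Mate → List (Fin n) → Set
  Closed m R = ∀ {v u} → v ∈ₗ R → m v ≡ just u → u ∈ₗ R

  switch : List (Fin n) → Mate → Mate → Mate
  switch R a b v with v ∈ₗ? R
  ... | yes _ = a v
  ... | no _ = b v

  switch-∈ : ∀ {R a b v} → v ∈ₗ R → switch R a b v ≡ a v
  switch-∈ {R} {v = v} v∈R with v ∈ₗ? R
  ... | yes _ = refl
  ... | no v∉R = contradiction v∈R v∉R

  switch-∉ : ∀ {R a b v} → v ∉ₗ R → switch R a b v ≡ b v
  switch-∉ {R} {v = v} v∉R with v ∈ₗ? R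
  ... | yes v∈R = contradiction v∈R v∉R
  ... | no _ = refl

  switch-isMatching : ∀ {R a b} → IsMatching a → IsMatching b → Closed a R → Closed b R →
                      IsMatching (switch R a b)
  switch-isMatching {R} isA isB closedA closedB {v} {u} eq with v ∈ₗ? R
  ... | yes v∈R = proj₁ (isA eq) , trans (switch-∈ (closedA v∈R eq)) (proj₂ (isA eq))
  ... | no v∉R = proj₁ (isB eq) , trans (switch-∉ u∉R) (proj₂ (isB eq))
    where
    u∉R : u ∉ₗ R
    u∉R u∈R = v∉R (closedB u∈R (proj₂ (isB eq)))

  switch-covers : ∀ {R a b S} → (∀ {v} → v ∉ S → v ∈ₗ R → Matched a v) →
                  (∀ {v} → v ∉ S → v ∉ₗ R → Matched b v) → Covers (switch R a b) S
  switch-covers {R} onR offR {v} v∉S with v ∈ₗ? R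
  ... | yes v∈R = onR v∉S v∈R
  ... | no v∉R = offR v∉S v∉R

  -- Walks in forests

  closedWalk⇒Cycle : ∀ {x y z r} → Linked (Adj G) (x ∷ y ∷ z ∷ r) → Unique (x ∷ y ∷ z ∷ r) →
                     Adj G (lookup (z ∷ r) (fromℕ (length r))) x → Cycle G (length r)
  closedWalk⇒Cycle {x} {y} {z} {r} walk u closing = record
    { c = lookup (x ∷ y ∷ z ∷ r)
    ; inj = Unique-lookup-injective u
    ; steps = Linked-lookup walk
    ; closing = closing
    }

  module _ (acyclic : Acyclic G) where

    -- A return v … v closes a cycle through the vertices strictly between, which
    -- has length at least 3 since the walk neither loops nor backtracks.
    nonBacktracking-noReturn : ∀ {v ws} → Linked (Adj G) (v ∷ ws) → NonBacktracking (v ∷ ws) →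
                               Unique ws → v ∉ₗ ws
    nonBacktracking-noReturn {v} walk nb u v∈ws with ∈-∃++ v∈ws
    ... | [] , _ , refl = Adj-irrefl (Linked.head walk)
    ... | _ ∷ [] , _ , refl = proj₁ nb refl
    ... | a ∷ b ∷ between , after , refl = closes between cycleWalk cycleUnique
      where
      cyc = a ∷ b ∷ between ++ [ v ]
      rearranged : cyc ++ after ≡ a ∷ b ∷ between ++ v ∷ after
      rearranged = cong (λ xs → a ∷ b ∷ xs) (++-assoc between [ v ] after)
      cycleWalk : Linked (Adj G) cyc
      cycleWalk = Linked-++⁻ˡ cyc (subst (Linked (Adj G)) (sym rearranged) (Linked.tail walk))
      cycleUnique : Unique cyc
      cycleUnique = AllPairs-++⁻ˡ cyc (subst Unique (sym rearranged) u)
      closes : ∀ bs → Linked (Adj G) (a ∷ b ∷ bs ++ [ v ]) → Unique (a ∷ b ∷ bs ++ [ v ]) → ⊥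
      closes [] cw cu = acyclic _ (closedWalk⇒Cycle cw cu (Linked.head walk))
      closes (c ∷ cs) cw cu = acyclic _ (closedWalk⇒Cycle cw cu
        (subst (λ z → Adj G z a) (sym (lookup-fromℕ-∷ʳ c cs v)) (Linked.head walk)))

    nonBacktracking⇒Unique : ∀ {ws} → Linked (Adj G) ws → NonBacktracking ws → Unique ws
    nonBacktracking⇒Unique {[]} _ _ = AllPairs.[]
    nonBacktracking⇒Unique {v ∷ ws} walk nb =
      Allₚ.¬Any⇒All¬ ws (nonBacktracking-noReturn walk nb u) AllPairs.∷ u
      where
      u = nonBacktracking⇒Unique (Linked.tail walk) (NonBacktracking-tail nb)

    nonBacktracking-length≤ : ∀ {ws} → Linked (Adj G) ws → NonBacktracking ws → length ws ≤ n
    nonBacktracking-length≤ walk nb = Unique⇒length≤ (nonBacktracking⇒Unique walk nb)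

    module _ {m S} (isM : IsMatching m) (covers : Covers m S) where

      -- a forces its partner v once every other neighbour x of a is blue; x ∉ S
      -- is forced by its own partner in turn, extending a non-backtracking walk.
      forcedByPartner : ∀ k {a v ws} → Linked (Adj G) (a ∷ v ∷ ws) → NonBacktracking (a ∷ v ∷ ws) →
                        n < k + length ws → m v ≡ just a → Blue G S v
      forcedByPartner zero walk nb bound _ =
        contradiction (<-≤-trans bound (≤-trans (m≤n+m _ 2) (nonBacktracking-length≤ walk nb)))
                      (<-irrefl refl)
      forcedByPartner (suc k) {a} {v} {ws} walk nb bound mv =
        force a (Adj-sym (proj₁ (isM mv))) others
        where
        others : ∀ x → Adj G a x → x ≢ v → Blue G S x
        others x ax x≢v with x ∈? S
        ... | yes x∈S = initial x∈S
        ... | no x∉S with covers x∉S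
        ...   | b , mx =
          forcedByPartner k (Adj-sym (proj₁ (isM mx)) Linked.∷ Adj-sym ax Linked.∷ walk)
                          (b≢a , x≢v , nb) bound′ mx
          where
          b≢a : b ≢ a
          b≢a refl = x≢v (just-injective (trans (sym (proj₂ (isM mx))) (proj₂ (isM mv))))
          bound′ : n < k + length (a ∷ v ∷ ws)
          bound′ = <-≤-trans (subst (n <_) (sym (+-suc k (length ws))) bound)
                             (+-monoʳ-≤ k (n≤1+n _))

      covering⇒skewForcing : SkewForcingSet G S
      covering⇒skewForcing v with v ∈? S
      ... | yes v∈S = initial v∈S
      ... | no v∉S with covers v∉S
      ...   | a , mv =
        forcedByPartner (suc n) (Adj-sym (proj₁ (isM mv)) Linked.∷ [-]) tt (s≤s (m≤m+n n 0)) mv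

    minimum⇒exact : ∀ {S} → MinSkewForcingSet G S → ExactMatching S
    minimum⇒exact {S} (forcing , minimal) with skewForcing⇒covering forcing
    ... | m , isM , covers =
      record { mate = m ; isMatching = isM ; covers = covers ; exposes = exposes }
      where
      exposes : ∀ {v} → v ∈ S → m v ≡ nothing
      exposes {v} v∈S with m v in mv
      ... | nothing = refl
      ... | just a =
        contradiction (minimal (S - v) (covering⇒skewForcing isM covers′)) (<⇒≱ (x∈p⇒∣p-x∣<∣p∣ v∈S))
        where
        covers′ : Covers m (S - v)
        covers′ {u} u∉S-v with u ≟ v
        ... | yes refl = a , mv
        ... | no u≢v = covers (λ u∈S → u∉S-v (x∈p∧x≢y⇒x∈p-y u∈S u≢v))

    module Alternation {S₁ S₂} (E₁ : ExactMatching S₁) (E₂ : ExactMatching S₂)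
                       {x} (x∈S₂ : x ∈ S₂) (x∉S₁ : x ∉ S₁) where
      open ExactMatching E₁ using () renaming (mate to m₁; isMatching to isM₁; covers to covers₁)
      open ExactMatching E₂
        using () renaming (mate to m₂; isMatching to isM₂; covers to covers₂; exposes to exposes₂)

      mate : Bool → Mate
      mate true = m₁
      mate false = m₂

      mate-isMatching : ∀ t → IsMatching (mate t)
      mate-isMatching true = isM₁
      mate-isMatching false = isM₂

      -- The walk x, m₁ x, m₂ (m₁ x), … listed backwards; the index is the
      -- matching that continues it from its last vertex.
      data Alternating : Bool → List (Fin n) → Set where
        start : Alternating true [ x ]
        step : ∀ {t h ws q} → Alternating t (h ∷ ws) → mate t h ≡ just q →
               Alternating (not t) (q ∷ h ∷ ws)

      alternating-arrival : ∀ {t h ws} → Alternating t (h ∷ ws) → mate (not t) h ≡ head ws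
      alternating-arrival start = exposes₂ x∈S₂
      alternating-arrival (step {t} _ e) =
        subst (λ s → mate s _ ≡ _) (sym (not-involutive t)) (proj₂ (mate-isMatching t e))

      alternating-walk : ∀ {t ws} → Alternating t ws → Linked (Adj G) ws
      alternating-walk start = [-]
      alternating-walk (step {t} a e) =
        Adj-sym (proj₁ (mate-isMatching t e)) Linked.∷ alternating-walk a

      -- If q = p, then h is the partner of p in both matchings, so the walk
      -- entered p from h and had already backtracked.
      step-nonBacktracking : ∀ {t p r h q} → Alternating t (p ∷ r) → mate t p ≡ just h →
                             mate (not t) h ≡ just q →
                             NonBacktracking (h ∷ p ∷ r) → NonBacktracking (q ∷ h ∷ p ∷ r)
      step-nonBacktracking {t} {p} {r} {h} {q} a _ hq nb = q≢p , nb
        where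
        enteredFrom : ∀ {r} → NonBacktracking (h ∷ p ∷ r) → head r ≢ just h
        enteredFrom {h′ ∷ _} (h≢h′ , _) eq = h≢h′ (sym (just-injective eq))
        q≢p : q ≢ p
        q≢p refl =
          enteredFrom nb (trans (sym (alternating-arrival a)) (proj₂ (mate-isMatching (not t) hq)))

      alternating-nonBacktracking : ∀ {t ws} → Alternating t ws → NonBacktracking ws
      alternating-nonBacktracking start = tt
      alternating-nonBacktracking (step start _) = tt
      alternating-nonBacktracking (step a′@(step a e′) e) =
        step-nonBacktracking a e′ e (alternating-nonBacktracking a′)

      alternating-x : ∀ {t ws} → Alternating t ws → x ∈ₗ ws
      alternating-x start = here refl
      alternating-x (step a _) = there (alternating-x a)

      alternating-length≤ : ∀ {t ws} → Alternating t ws → length ws ≤ n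
      alternating-length≤ a =
        nonBacktracking-length≤ (alternating-walk a) (alternating-nonBacktracking a)

      matched-last : ∀ {t h ws} → Alternating t (h ∷ ws) → h ≢ x → Matched (mate (not t)) h
      matched-last {ws = []} a h≢x with alternating-x a
      ... | here x≡h = contradiction (sym x≡h) h≢x
      matched-last {ws = w ∷ _} a _ = w , alternating-arrival a

      partner-last : ∀ {t h ws} s {u} → Alternating t (h ∷ ws) → mate s h ≡ just u →
                     mate t h ≡ just u ⊎ u ∈ₗ ws
      partner-last {t} s a e with s ≟ᵇ t
      ... | yes refl = inj₁ e
      ... | no s≢t = inj₂ (head≡just⇒∈ (trans (sym (alternating-arrival a)) e′))
        where
        e′ : mate (not t) _ ≡ _
        e′ = subst (λ s → mate s _ ≡ _) (¬-not s≢t) e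

      matched-interior : ∀ {t h ws v} → Alternating t (h ∷ ws) → v ∈ₗ ws → v ≢ x →
                         Matched m₁ v × Matched m₂ v
      matched-interior (step {t} {h} {q = q} a e) (here refl) h≢x =
        both t (q , e) (matched-last a h≢x)
        where
        both : ∀ t → Matched (mate t) h → Matched (mate (not t)) h → Matched m₁ h × Matched m₂ h
        both true p₁ p₂ = p₁ , p₂
        both false p₂ p₁ = p₁ , p₂
      matched-interior (step a _) (there v∈ws) v≢x = matched-interior a v∈ws v≢x

      closed-interior : ∀ {t h ws} s → Alternating t (h ∷ ws) →
                        ∀ {v u} → v ∈ₗ ws → mate s v ≡ just u → u ∈ₗ h ∷ ws
      closed-interior s (step a e) (here refl) e′ with partner-last s a e′
      ... | inj₁ e″ = here (just-injective (trans (sym e″) e))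
      ... | inj₂ u∈ws = there (there u∈ws)
      closed-interior s (step a _) (there v∈ws) e′ = there (closed-interior s a v∈ws e′)

      closed-maximal : ∀ {t h ws} → Alternating t (h ∷ ws) → mate t h ≡ nothing →
                       ∀ s → Closed (mate s) (h ∷ ws)
      closed-maximal a stuck s (here refl) e with partner-last s a e
      ... | inj₁ e′ with trans (sym stuck) e′
      ...   | ()
      closed-maximal a stuck s (here refl) e | inj₂ u∈ws = there u∈ws
      closed-maximal a stuck s (there v∈ws) e = closed-interior s a v∈ws e

      record Maximal : Set where
        constructor maximal
        field
          {turn} : Bool
          {last} : Fin n
          {earlier} : List (Fin n)
          alternating : Alternating turn (last ∷ earlier)
          stuck : mate turn last ≡ nothing

      extendToMaximal : ∀ k {t h ws} → Alternating t (h ∷ ws) → n < k + length ws → Maximal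
      extendToMaximal zero a bound =
        contradiction (<-trans bound (alternating-length≤ a)) (<-irrefl refl)
      extendToMaximal (suc k) {t} {h} {ws} a bound with mate t h in e
      ... | nothing = maximal a e
      ... | just q = extendToMaximal k (step a e) (subst (n <_) (sym (+-suc k (length ws))) bound)

      exchangeable : ∀ {h ws} → Alternating true (h ∷ ws) → m₁ h ≡ nothing →
                     h ∈ S₁ × h ∉ S₂ × SkewForcingSet G (replace S₁ h x)
      exchangeable {h} {ws} a stuck =
        h∈S₁ , ExactMatching.matched⇒∉ E₂ (matched-last a h≢x) ,
        covering⇒skewForcing isM (switch-covers onR offR)
        where
        h∈S₁ : h ∈ S₁
        h∈S₁ = unmatched⇒∈ covers₁ stuck
        h≢x : h ≢ x
        h≢x refl = x∉S₁ h∈S₁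
        isM : IsMatching (switch (h ∷ ws) m₂ m₁)
        isM = switch-isMatching isM₂ isM₁ (closed-maximal a stuck false)
                                          (closed-maximal a stuck true)
        onR : ∀ {v} → v ∉ replace S₁ h x → v ∈ₗ h ∷ ws → Matched m₂ v
        onR _ (here refl) = matched-last a h≢x
        onR v∉ (there v∈ws) = proj₂ (matched-interior a v∈ws (∉replace⇒≢ v∉))
        offR : ∀ {v} → v ∉ replace S₁ h x → v ∉ₗ h ∷ ws → Matched m₁ v
        offR v∉ v∉R = covers₁ (λ v∈S₁ → v∉ (∈replace⁺ v∈S₁ (λ { refl → v∉R (here refl) })))

      x-removable : ∀ {h ws} → Alternating false (h ∷ ws) → m₂ h ≡ nothing →
                    SkewForcingSet G (S₂ - x)
      x-removable {h} {ws} a stuck = covering⇒skewForcing isM (switch-covers onR offR)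
        where
        isM : IsMatching (switch (h ∷ ws) m₁ m₂)
        isM = switch-isMatching isM₁ isM₂ (closed-maximal a stuck true)
                                          (closed-maximal a stuck false)
        onR : ∀ {v} → v ∉ S₂ - x → v ∈ₗ h ∷ ws → Matched m₁ v
        onR {v} _ v∈R with v ≟ x
        ... | yes refl = covers₁ x∉S₁
        onR _ (here refl) | no v≢x = matched-last a v≢x
        onR _ (there v∈ws) | no v≢x = proj₁ (matched-interior a v∈ws v≢x)
        offR : ∀ {v} → v ∉ S₂ - x → v ∉ₗ h ∷ ws → Matched m₂ v
        offR v∉ v∉R =
          covers₂ (λ v∈S₂ → v∉ (x∈p∧x≢y⇒x∈p-y v∈S₂ (λ { refl → v∉R (alternating-x a) })))

      exchangeOrRemove : (∃ λ y → y ∈ S₁ × y ∉ S₂ × SkewForcingSet G (replace S₁ y x))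
                         ⊎ SkewForcingSet G (S₂ - x)
      exchangeOrRemove with extendToMaximal (suc n) start (s≤s (m≤m+n n 0))
      ... | maximal {true} a stuck = inj₁ (_ , exchangeable a stuck)
      ... | maximal {false} a stuck = inj₂ (x-removable a stuck)

    exchange : ∀ {S₁ S₂} → MinSkewForcingSet G S₁ → MinSkewForcingSet G S₂ →
               ∀ {x} → x ∈ S₂ → x ∉ S₁ →
               ∃ λ y → y ∈ S₁ × y ∉ S₂ × MinSkewForcingSet G (replace S₁ y x)
    exchange min₁ min₂ {x} x∈S₂ x∉S₁
      with Alternation.exchangeOrRemove (minimum⇒exact min₁) (minimum⇒exact min₂) x∈S₂ x∉S₁
    ... | inj₁ (y , y∈S₁ , y∉S₂ , forcing) =
      y , y∈S₁ , y∉S₂ , forcing , λ B fB → ≤-trans (∣replace∣≤∣S∣ x y∈S₁) (proj₂ min₁ B fB)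
    ... | inj₂ forcing = contradiction (proj₂ min₂ _ forcing) (<⇒≱ (x∈p⇒∣p-x∣<∣p∣ x∈S₂))

    TEPath : ∀ k {S₁ S₂} → MinSkewForcingSet G S₁ → MinSkewForcingSet G S₂ →
             ∣ S₂ ∩ ∁ S₁ ∣ < k → Star (TEAdj G) S₁ S₂
    TEPath k {S₁} {S₂} min₁ min₂ _ with any? (λ v → v ∈? S₂ ×-dec ¬? (v ∈? S₁))
    ... | no none =
      subst (Star (TEAdj G) S₁) (sym (p⊆q∧∣q∣≤∣p∣⇒p≡q S₂⊆S₁ (proj₂ min₁ S₂ (proj₁ min₂)))) ε
      where
      S₂⊆S₁ : S₂ ⊆ S₁
      S₂⊆S₁ {v} v∈S₂ with v ∈? S₁
      ... | yes v∈S₁ = v∈S₁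
      ... | no v∉S₁ = contradiction (v , v∈S₂ , v∉S₁) none
    TEPath (suc k) {S₁} {S₂} min₁ min₂ bound | yes (x , x∈S₂ , x∉S₁)
      with exchange min₁ min₂ x∈S₂ x∉S₁
    ... | y , y∈S₁ , y∉S₂ , min′ = edge ◅ TEPath k min′ min₂ bound′
      where
      edge : TEAdj G S₁ (replace S₁ y x)
      edge = min₁ , min′ , y , x , y∈S₁ , y∉replace (λ { refl → x∉S₁ y∈S₁ }) , x∈replace x , x∉S₁ ,
             replace-∩∁ x∉S₁
      bound′ : ∣ S₂ ∩ ∁ (replace S₁ y x) ∣ < k
      bound′ = <-≤-trans (∣T∖replace∣<∣T∖S∣ y∉S₂ x∈S₂ x∉S₁) (≤-pred bound)

mainTheorem17 : ∀ (n : ℕ) (T : Graph n) → IsTree T → TEConnected T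
mainTheorem17 n T (_ , acyclic) S₁ S₂ min₁ min₂ =
  TEPath T acyclic (suc ∣ S₂ ∩ ∁ S₁ ∣) min₁ min₂ ≤-refl
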